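{- Let $k,m$ and $n_1,\dots,n_m$ be positive integers, $d$ an integer, and for $1\le i\le m$ let $A_i,B_i\in\mathbb{F}_q^{k\times n_i}$ with $\mathrm{rk}(A_1\mid\cdots\mid A_m)=\mathrm{rk}(B_1\mid\cdots\mid B_m)=k$. Suppose that for some $i\in\{1,\dots,m\}$ one of the following holds: (1) $\mathrm{rk}A_i=\mathrm{rk}B_i=k$ and $d\le d_S(\tau^{ -1}(A_i),\tau^{ -1}(B_i))$; (2) $A_i=B_i$, $\mathrm{rk}A_i=k$ and $d/2\le\mathrm{rk}\big((A_1\mid\cdots\mid A_{i-1}\mid A_{i+1}\mid\cdots\mid A_m)-(B_1\mid\cdots\mid B_{i-1}\mid B_{i+1}\mid\cdots\mid B_m)\big)$; (3) $d/2\le|\mathrm{rk}A_i-\mathrm{rk}B_i|$. Then $d\le d_S(\tau^{ -1}(A_1\mid\cdots\mid A_m),\tau^{ -1}(B_1\mid\cdots\mid B_m))$.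
   Context: $\mid$ denotes horizontal concatenation of matrices. For a matrix $X$ of full row rank, $\tau^{ -1}(X)$ denotes its row space. For subspaces $U,W$ of a common vector space, $d_S(U,W)=\dim(U+W)-\dim(U\cap W)$. -}

module Defs where

open import Level using (Level; _⊔_; suc)
open import Algebra.Bundles using (CommutativeRing)
open import Data.Nat as ℕ using (ℕ; zero)
open import Data.Fin using (Fin; splitAt; punchIn)
import Data.Fin as Fin
open import Data.Sum using (inj₁; inj₂)
open import Data.Product using (Σ; ∃; ∃-syntax; _×_)
open import Relation.Binary.PropositionalEquality using (_≡_)
open import Relation.Nullary using (¬_)
open import Data.Integer as ℤ using (ℤ; +_)
import Algebra.Definitions.RawMonoid as RawMonoidDefs

record Field (c ℓ : Level) : Set (suc (c ⊔ ℓ)) where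
  field
    commutativeRing : CommutativeRing c ℓ
  open CommutativeRing commutativeRing public
  field
    1≉0     : ¬ (1# ≈ 0#)
    inverse : ∀ x → ¬ (x ≈ 0#) → ∃[ y ] (x * y ≈ 1#)

record FiniteField (c ℓ : Level) : Set (suc (c ⊔ ℓ)) where
  field
    field'    : Field c ℓ
    q         : ℕ
    enum      : Fin q → Field.Carrier field'
    enum-inj  : ∀ i j → Field._≈_ field' (enum i) (enum j) → i ≡ j
    enum-surj : ∀ x → ∃[ i ] Field._≈_ field' (enum i) x
  open Field field' public

module LinAlg {c ℓ : Level} (F : Field c ℓ) where
  open Field F
  open RawMonoidDefs +-rawMonoid using (sum)

  Vec : ℕ → Set c
  Vec N = Fin N → Carrier

  Matrix : ℕ → ℕ → Set c
  Matrix k N = Fin k → Fin N → Carrier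

  Subset : ℕ → Set (suc (c ⊔ ℓ))
  Subset N = Vec N → Set (c ⊔ ℓ)

  lincomb : ∀ {r N} → (Fin r → Carrier) → (Fin r → Vec N) → Vec N
  lincomb cs vs t = sum (λ j → cs j * vs j t)

  LinIndep : ∀ {r N} → (Fin r → Vec N) → Set (c ⊔ ℓ)
  LinIndep {r} vs = ∀ (cs : Fin r → Carrier) →
    (∀ t → lincomb cs vs t ≈ 0#) → ∀ j → cs j ≈ 0#

  Dim : ∀ {N} → Subset N → ℕ → Set (c ⊔ ℓ)
  Dim {N} S r =
    (∃[ vs ] ((∀ j → S (vs j)) × LinIndep {r} {N} vs)) ×
    (∀ (vs : Fin (ℕ.suc r) → Vec N) → (∀ j → S (vs j)) → ¬ LinIndep vs)

  _+ₛ_ : ∀ {N} → Subset N → Subset N → Subset N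
  (U +ₛ W) v = ∃[ u ] ∃[ w ] (U u × W w × (∀ t → v t ≈ u t + w t))

  _∩ₛ_ : ∀ {N} → Subset N → Subset N → Subset N
  (U ∩ₛ W) v = U v × W v

  SubspaceDist : ∀ {N} → Subset N → Subset N → ℤ → Set (c ⊔ ℓ)
  SubspaceDist U W δ =
    ∃[ a ] ∃[ b ] (Dim (U +ₛ W) a × Dim (U ∩ₛ W) b × δ ≡ (+ a) ℤ.- (+ b))

  RowSpace : ∀ {k N} → Matrix k N → Subset N
  RowSpace {k} X v = ∃[ cs ] (∀ t → v t ≈ lincomb {k} cs X t)

  Rank : ∀ {k N} → Matrix k N → ℕ → Set (c ⊔ ℓ)
  Rank X r = Dim (RowSpace X) r

  _-ₘ_ : ∀ {k N} → Matrix k N → Matrix k N → Matrix k N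
  (X -ₘ Y) r t = X r t - Y r t

  total : (m : ℕ) → (Fin m → ℕ) → ℕ
  total zero n = 0
  total (ℕ.suc m) n = n Fin.zero ℕ.+ total m (λ i → n (Fin.suc i))

  concat : ∀ {k} (m : ℕ) (n : Fin m → ℕ) →
           ((i : Fin m) → Matrix k (n i)) → Matrix k (total m n)
  concat zero n A r ()
  concat (ℕ.suc m) n A r t with splitAt (n Fin.zero) t
  ... | inj₁ t₁ = A Fin.zero r t₁
  ... | inj₂ t₂ = concat m (λ i → n (Fin.suc i)) (λ i → A (Fin.suc i)) r t₂

  concatWithout : ∀ {k} (m : ℕ) (n : Fin (ℕ.suc m) → ℕ) (i : Fin (ℕ.suc m)) →
                  ((j : Fin (ℕ.suc m)) → Matrix k (n j)) →
                  Matrix k (total m (λ j → n (punchIn i j)))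
  concatWithout m n i A = concat m (λ j → n (punchIn i j)) (λ j → A (punchIn i j))

{-# OPTIONS --safe #-}
-- Write X = (A₁ | ⋯ | A_m), Y = (B₁ | ⋯ | B_m), a = dim(τ⁻¹X + τ⁻¹Y) and b = dim(τ⁻¹X ∩ τ⁻¹Y), so that
-- d_S = a − b and, by Grassmann, a + b ≤ 2k. Restricting vectors to the columns of block i maps
-- τ⁻¹X + τ⁻¹Y onto τ⁻¹Aᵢ + τ⁻¹Bᵢ and, as Aᵢ has full rank in case (1), maps τ⁻¹X ∩ τ⁻¹Y injectively
-- into τ⁻¹Aᵢ ∩ τ⁻¹Bᵢ; this gives case (1). In cases (2) and (3) it suffices to find k + D independent
-- vectors in τ⁻¹X + τ⁻¹Y with d ≤ 2D, since then 2D ≤ 2(a − k) ≤ a − b. In case (2) these are the rows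
-- of X together with lifts of a basis of the row space of the difference of the other blocks, which
-- vanish on block i. In case (3) they are a basis of the vectors of τ⁻¹X vanishing on block i, whose
-- dimension is at least k − rk Aᵢ, together with lifts of a basis of τ⁻¹Bᵢ; doing this also with X and
-- Y exchanged gives D = |rk Aᵢ − rk Bᵢ|.
module Submission where

open import Defs
open import Level using (Level; _⊔_)
open import Data.Nat using (ℕ; suc; _≤_)
open import Data.Fin using (Fin)
open import Data.Product using (∃-syntax; _×_)
open import Data.Sum using (_⊎_)

import Data.Nat as ℕ
import Data.Nat.Properties as ℕP
import Data.Integer.Properties as ℤP
open import Data.Integer as ℤ using (ℤ; +_)
import Data.Fin as F
import Data.Fin.Properties as FP
open import Data.Fin using (_↑ˡ_; _↑ʳ_; splitAt)
open import Data.Vec.Functional using (_++_; _∷_)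
open import Data.Vec.Functional.Properties using (lookup-++ˡ; lookup-++ʳ)
open import Data.Product using (Σ; _,_; proj₁; proj₂)
open import Data.Sum using (inj₁; inj₂; [_,_])
open import Data.Empty using (⊥-elim)
open import Relation.Nullary using (¬_; ¬?; Dec; yes; no; _×-dec_)
open import Relation.Nullary.Decidable using (decidable-stable; map′)
open import Relation.Binary.Definitions using (Decidable)
open import Relation.Binary.PropositionalEquality as P using (_≡_)
open import Function using (_∘_)
import Algebra.Properties.Semiring.Sum as SemiringSum
import Algebra.Properties.Ring as RingProperties

module Arithmetic where
  open import Data.Nat using (_+_; _∸_; _*_)
  open import Data.Nat.Tactic.RingSolver using (solve-∀)

  twice-excess+b≤a : ∀ {a b k D} → a + b ≤ k + k → k + D ≤ a → 2 * D + b ≤ a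
  twice-excess+b≤a {a} {b} {k} {D} a+b≤2k k+D≤a = ℕP.+-cancelʳ-≤ (k + k) (2 * D + b) a (begin
    2 * D + b + (k + k)      ≡⟨ rearrange k D b ⟩
    k + D + (k + D + b)      ≤⟨ ℕP.+-mono-≤ k+D≤a (ℕP.+-monoˡ-≤ b k+D≤a) ⟩
    a + (a + b)              ≤⟨ ℕP.+-monoʳ-≤ a a+b≤2k ⟩
    a + (k + k)              ∎)
    where
    open ℕP.≤-Reasoning
    rearrange : ∀ k D b → 2 * D + b + (k + k) ≡ k + D + (k + D + b)
    rearrange = solve-∀

  twice-excess≤distance : ∀ {a b k D} → a + b ≤ k + k → k + D ≤ a → + 2 ℤ.* + D ℤ.≤ + a ℤ.- + b
  twice-excess≤distance {a} {b} {k} {D} a+b≤2k k+D≤a = begin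
    + 2 ℤ.* + D   ≡⟨ ℤP.pos-* 2 D ⟨
    + (2 * D)     ≤⟨ ℤ.+≤+ (ℕP.m+n≤o⇒m≤o∸n (2 * D) 2D+b≤a) ⟩
    + (a ∸ b)     ≡⟨ ℤP.⊖-≥ b≤a ⟨
    a ℤ.⊖ b       ≡⟨ ℤP.m-n≡m⊖n a b ⟨
    + a ℤ.- + b   ∎
    where
    open ℤP.≤-Reasoning
    2D+b≤a : 2 * D + b ≤ a
    2D+b≤a = twice-excess+b≤a {a} {b} {k} {D} a+b≤2k k+D≤a
    b≤a : b ≤ a
    b≤a = ℕP.≤-trans (ℕP.m≤n+m b (2 * D)) 2D+b≤a

  k+[y∸x]≤a : ∀ {k a x y} → k + y ≤ a + x → x ≤ y → k + (y ∸ x) ≤ a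
  k+[y∸x]≤a {k} {a} {x} {y} k+y≤a+x x≤y =
    P.subst (_≤ a) (ℕP.+-∸-assoc k x≤y)
      (ℕP.m≤n+o⇒m∸n≤o (k + y) x (P.subst (k + y ≤_) (ℕP.+-comm a x) k+y≤a+x))

  grassmann-count : ∀ {a b e₁ e₂ p q} → a ≤ e₁ + (e₂ + b) → e₁ + b ≡ p → e₂ + b ≡ q → a + b ≤ p + q
  grassmann-count {a} {b} {e₁} {e₂} a≤ P.refl P.refl = P.subst (a + b ≤_) (rearrange e₁ e₂ b) (ℕP.+-monoˡ-≤ b a≤)
    where
    rearrange : ∀ e₁ e₂ b → e₁ + (e₂ + b) + b ≡ e₁ + b + (e₂ + b)
    rearrange = solve-∀

  k≤x+κ⇒k+y≤a+x : ∀ {k a x y κ} → k ≤ x + κ → κ + y ≤ a → k + y ≤ a + x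
  k≤x+κ⇒k+y≤a+x {k} {a} {x} {y} {κ} k≤x+κ κ+y≤a = begin
    k + y          ≤⟨ ℕP.+-monoˡ-≤ y k≤x+κ ⟩
    x + κ + y      ≡⟨ ℕP.+-assoc x κ y ⟩
    x + (κ + y)    ≤⟨ ℕP.+-monoʳ-≤ x κ+y≤a ⟩
    x + a          ≡⟨ ℕP.+-comm x a ⟩
    a + x          ∎
    where open ℕP.≤-Reasoning

  ∣x-y∣≡y∸x : ∀ {x y} → x ≤ y → ℤ.∣ + x ℤ.- + y ∣ ≡ y ∸ x
  ∣x-y∣≡y∸x {x} {y} x≤y = P.trans (P.cong ℤ.∣_∣ (ℤP.m-n≡m⊖n x y)) (ℤP.∣⊖∣-≤ x≤y)

  k+∣x-y∣≤a : ∀ {k a x y} → k + x ≤ a + y → k + y ≤ a + x → k + ℤ.∣ + x ℤ.- + y ∣ ≤ a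
  k+∣x-y∣≤a {k} {a} {x} {y} k+x≤a+y k+y≤a+x with ℕP.≤-total x y
  ... | inj₁ x≤y = P.subst (λ e → k + e ≤ a) (P.sym (∣x-y∣≡y∸x x≤y)) (k+[y∸x]≤a k+y≤a+x x≤y)
  ... | inj₂ y≤x = P.subst (λ e → k + e ≤ a) (P.sym (P.trans (ℤP.∣i-j∣≡∣j-i∣ (+ x) (+ y)) (∣x-y∣≡y∸x y≤x)))
                     (k+[y∸x]≤a k+x≤a+y y≤x)

open Arithmetic

∀-split : ∀ {p} {m n} {Q : Fin (m ℕ.+ n) → Set p} →
          (∀ i → Q (i ↑ˡ n)) → (∀ j → Q (m ↑ʳ j)) → ∀ i → Q i
∀-split {m = m} {Q = Q} left right i with splitAt m i in eq
... | inj₁ j = P.subst Q (FP.splitAt⁻¹-↑ˡ eq) (left j)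
... | inj₂ j = P.subst Q (FP.splitAt⁻¹-↑ʳ eq) (right j)

∀-++ : ∀ {a p} {A : Set a} {m n} (Q : A → Set p) {xs : Fin m → A} {ys : Fin n → A} →
       (∀ i → Q (xs i)) → (∀ j → Q (ys j)) → ∀ i → Q ((xs ++ ys) i)
∀-++ {m = m} Q q-xs q-ys i with splitAt m i
... | inj₁ j = q-xs j
... | inj₂ j = q-ys j

∷-++ : ∀ {a} {A : Set a} {m n} (x : A) (xs : Fin m → A) (ys : Fin n → A) i →
       (x ∷ (xs ++ ys)) i ≡ ((x ∷ xs) ++ ys) i
∷-++ x xs ys F.zero = P.refl
∷-++ {m = m} x xs ys (F.suc i) with splitAt m i
... | inj₁ _ = P.refl
... | inj₂ _ = P.refl

module SpanProperties {c ℓ : Level} (F : Field c ℓ) where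
  open Field F
  open LinAlg F
  open SemiringSum semiring
    using (sum; sum-cong-≋; sum-replicate-zero; ∑-distrib-+; ∑-comm; sum-remove; *-distribˡ-sum; *-distribʳ-sum)
  open RingProperties ring using (-1*x≈-x; -‿distribʳ-*)
  open import Relation.Binary.Reasoning.Setoid setoid

  _≋_ : ∀ {N} → Vec N → Vec N → Set ℓ
  u ≋ v = ∀ t → u t ≈ v t

  0ᵛ : ∀ {N} → Vec N
  0ᵛ _ = 0#

  sum-zero : ∀ {n} {f : Fin n → Carrier} → (∀ i → f i ≈ 0#) → sum f ≈ 0#
  sum-zero {n} f≈0 = trans (sum-cong-≋ f≈0) (sum-replicate-zero n)

  sum-neg : ∀ {n} (f : Fin n → Carrier) → sum (λ i → - f i) ≈ - sum f
  sum-neg f = begin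
    sum (λ i → - f i)       ≈⟨ sum-cong-≋ (λ i → -1*x≈-x (f i)) ⟨
    sum (λ i → - 1# * f i)  ≈⟨ *-distribˡ-sum (- 1#) f ⟨
    - 1# * sum f            ≈⟨ -1*x≈-x (sum f) ⟩
    - sum f                 ∎

  sum-split : ∀ m {n} (f : Fin (m ℕ.+ n) → Carrier) →
              sum f ≈ sum (f ∘ (_↑ˡ n)) + sum (f ∘ (m ↑ʳ_))
  sum-split ℕ.zero f = sym (+-identityˡ _)
  sum-split (suc m) f = trans (+-congˡ (sum-split m (f ∘ F.suc))) (sym (+-assoc _ _ _))

  sum-single : ∀ {n} (i : Fin (suc n)) (f : Fin (suc n) → Carrier) →
               (∀ j → f (F.punchIn i j) ≈ 0#) → sum f ≈ f i
  sum-single i f others≈0 = trans (sum-remove {i = i} f) (trans (+-congˡ (sum-zero others≈0)) (+-identityʳ _))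

  δ : ∀ {n} → Fin n → Fin n → Carrier
  δ i j with i F.≟ j
  ... | yes _ = 1#
  ... | no _ = 0#

  δ-diag : ∀ {n} (i : Fin n) → δ i i ≈ 1#
  δ-diag i with i F.≟ i
  ... | yes _ = refl
  ... | no i≢i = ⊥-elim (i≢i P.refl)

  δ-off : ∀ {n} {i j : Fin n} → ¬ i ≡ j → δ i j ≈ 0#
  δ-off {i = i} {j} i≢j with i F.≟ j
  ... | yes i≡j = ⊥-elim (i≢j i≡j)
  ... | no _ = refl

  sum-δ* : ∀ {n} (i : Fin n) (g : Fin n → Carrier) → sum (λ j → δ i j * g j) ≈ g i
  sum-δ* {suc n} i g = trans
    (sum-single i (λ j → δ i j * g j) (λ j → trans (*-congʳ (δ-off (FP.punchInᵢ≢i i j ∘ P.sym))) (zeroˡ _)))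
    (trans (*-congʳ (δ-diag i)) (*-identityˡ _))

  sum-*δ : ∀ {n} (i : Fin n) (g : Fin n → Carrier) → sum (λ j → g j * δ j i) ≈ g i
  sum-*δ {suc n} i g = trans
    (sum-single i (λ j → g j * δ j i) (λ j → trans (*-congˡ (δ-off (FP.punchInᵢ≢i i j))) (zeroʳ _)))
    (trans (*-congˡ (δ-diag i)) (*-identityʳ _))

  lincomb-cong : ∀ {r N} {cs ds : Fin r → Carrier} {vs ws : Fin r → Vec N} →
                 (∀ j → cs j ≈ ds j) → (∀ j → vs j ≋ ws j) → lincomb cs vs ≋ lincomb ds ws
  lincomb-cong {r} cs≈ds vs≋ws t = sum-cong-≋ {r} (λ j → *-cong (cs≈ds j) (vs≋ws j t))

  lincomb-congˡ : ∀ {r N} {cs ds : Fin r → Carrier} (vs : Fin r → Vec N) →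
                  (∀ j → cs j ≈ ds j) → lincomb cs vs ≋ lincomb ds vs
  lincomb-congˡ vs cs≈ds = lincomb-cong {vs = vs} cs≈ds (λ _ _ → refl)

  lincomb-zeroˡ : ∀ {r N} {cs : Fin r → Carrier} (vs : Fin r → Vec N) →
                  (∀ j → cs j ≈ 0#) → lincomb cs vs ≋ 0ᵛ
  lincomb-zeroˡ {r} vs cs≈0 t = sum-zero {r} (λ j → trans (*-congʳ (cs≈0 j)) (zeroˡ _))

  lincomb-zeroʳ : ∀ {r N} (cs : Fin r → Carrier) {vs : Fin r → Vec N} →
                  (∀ j → vs j ≋ 0ᵛ) → lincomb cs vs ≋ 0ᵛ
  lincomb-zeroʳ {r} cs vs≋0 t = sum-zero {r} (λ j → trans (*-congˡ (vs≋0 j t)) (zeroʳ _))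

  lincomb-+ : ∀ {r N} (cs ds : Fin r → Carrier) (vs : Fin r → Vec N) t →
              lincomb (λ j → cs j + ds j) vs t ≈ lincomb cs vs t + lincomb ds vs t
  lincomb-+ {r} cs ds vs t =
    trans (sum-cong-≋ {r} (λ j → distribʳ _ _ _)) (∑-distrib-+ (λ j → cs j * vs j t) (λ j → ds j * vs j t))

  lincomb-* : ∀ {r N} (a : Carrier) (cs : Fin r → Carrier) (vs : Fin r → Vec N) t →
              lincomb (λ j → a * cs j) vs t ≈ a * lincomb cs vs t
  lincomb-* {r} a cs vs t =
    trans (sum-cong-≋ {r} (λ j → *-assoc _ _ _)) (sym (*-distribˡ-sum a (λ j → cs j * vs j t)))

  lincomb-neg : ∀ {r N} (cs : Fin r → Carrier) (vs : Fin r → Vec N) t →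
                lincomb (λ j → - cs j) vs t ≈ - lincomb cs vs t
  lincomb-neg cs vs t = begin
    lincomb (λ j → - cs j) vs t      ≈⟨ lincomb-congˡ vs (λ j → -1*x≈-x (cs j)) t ⟨
    lincomb (λ j → - 1# * cs j) vs t ≈⟨ lincomb-* (- 1#) cs vs t ⟩
    - 1# * lincomb cs vs t           ≈⟨ -1*x≈-x _ ⟩
    - lincomb cs vs t                ∎

  lincomb--ₘ : ∀ {r N} (cs : Fin r → Carrier) (X Y : Matrix r N) t →
               lincomb cs (X -ₘ Y) t ≈ lincomb cs X t - lincomb cs Y t
  lincomb--ₘ {r} cs X Y t = begin
    sum (λ j → cs j * (X j t - Y j t))
      ≈⟨ sum-cong-≋ {r} (λ j → distribˡ _ _ _) ⟩
    sum (λ j → cs j * X j t + cs j * - Y j t)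
      ≈⟨ ∑-distrib-+ (λ j → cs j * X j t) (λ j → cs j * - Y j t) ⟩
    lincomb cs X t + sum (λ j → cs j * - Y j t)
      ≈⟨ +-congˡ (sum-cong-≋ {r} (λ j → sym (-‿distribʳ-* (cs j) (Y j t)))) ⟩
    lincomb cs X t + sum (λ j → - (cs j * Y j t))
      ≈⟨ +-congˡ (sum-neg (λ j → cs j * Y j t)) ⟩
    lincomb cs X t - lincomb cs Y t ∎

  lincomb-lincomb : ∀ {r s N} (cs : Fin r → Carrier) (vs : Fin r → Vec N)
                    (C : Fin r → Fin s → Carrier) (ws : Fin s → Vec N) →
                    (∀ j → vs j ≋ lincomb (C j) ws) →
                    lincomb cs vs ≋ lincomb (λ l → sum (λ j → cs j * C j l)) ws
  lincomb-lincomb {r} {s} cs vs C ws vs≋ t = begin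
    sum (λ j → cs j * vs j t)
      ≈⟨ sum-cong-≋ {r} (λ j → *-congˡ (vs≋ j t)) ⟩
    sum (λ j → cs j * sum (λ l → C j l * ws l t))
      ≈⟨ sum-cong-≋ {r} (λ j → *-distribˡ-sum (cs j) (λ l → C j l * ws l t)) ⟩
    sum (λ j → sum (λ l → cs j * (C j l * ws l t)))
      ≈⟨ ∑-comm (λ j l → cs j * (C j l * ws l t)) ⟩
    sum (λ l → sum (λ j → cs j * (C j l * ws l t)))
      ≈⟨ sum-cong-≋ (λ l → sum-cong-≋ {r} (λ j → *-assoc (cs j) (C j l) (ws l t))) ⟨
    sum (λ l → sum (λ j → cs j * C j l * ws l t))
      ≈⟨ sum-cong-≋ (λ l → *-distribʳ-sum (ws l t) (λ j → cs j * C j l)) ⟨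
    sum (λ l → sum (λ j → cs j * C j l) * ws l t) ∎

  lincomb-split : ∀ {m n N} (γ : Fin (m ℕ.+ n) → Carrier) (vs : Fin (m ℕ.+ n) → Vec N) t →
                  lincomb γ vs t ≈ lincomb (γ ∘ (_↑ˡ n)) (vs ∘ (_↑ˡ n)) t + lincomb (γ ∘ (m ↑ʳ_)) (vs ∘ (m ↑ʳ_)) t
  lincomb-split {m} γ vs t = sum-split m (λ j → γ j * vs j t)

  lincomb-++ᵛ : ∀ {m n N} (γ : Fin (m ℕ.+ n) → Carrier) (vs : Fin m → Vec N) (ws : Fin n → Vec N) t →
                lincomb γ (vs ++ ws) t ≈ lincomb (γ ∘ (_↑ˡ n)) vs t + lincomb (γ ∘ (m ↑ʳ_)) ws t
  lincomb-++ᵛ {m} {n} γ vs ws t = trans (lincomb-split {m} {n} γ (vs ++ ws) t) (+-cong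
    (lincomb-cong (λ _ → refl) (λ j t → reflexive (P.cong (λ v → v t) (lookup-++ˡ vs ws j))) t)
    (lincomb-cong (λ _ → refl) (λ j t → reflexive (P.cong (λ v → v t) (lookup-++ʳ vs ws j))) t))

  lincomb-++ : ∀ {m n N} (cs : Fin m → Carrier) (ds : Fin n → Carrier) (vs : Fin m → Vec N) (ws : Fin n → Vec N) t →
               lincomb (cs ++ ds) (vs ++ ws) t ≈ lincomb cs vs t + lincomb ds ws t
  lincomb-++ cs ds vs ws t = trans (lincomb-++ᵛ (cs ++ ds) vs ws t)
    (+-cong (lincomb-congˡ vs (λ j → reflexive (lookup-++ˡ cs ds j)) t)
            (lincomb-congˡ ws (λ j → reflexive (lookup-++ʳ cs ds j)) t))

  RowSpace-resp : ∀ {k N} (X : Matrix k N) {u v : Vec N} → u ≋ v → RowSpace X u → RowSpace X v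
  RowSpace-resp X u≋v (cs , u≈) = cs , λ t → trans (sym (u≋v t)) (u≈ t)

  RowSpace-lincomb : ∀ {k r N} (X : Matrix k N) (cs : Fin r → Carrier) (vs : Fin r → Vec N) →
                     (∀ j → RowSpace X (vs j)) → RowSpace X (lincomb cs vs)
  RowSpace-lincomb X cs vs vs∈X = _ , lincomb-lincomb cs vs (λ j → proj₁ (vs∈X j)) X (λ j → proj₂ (vs∈X j))

  RowSpace-row : ∀ {k N} (X : Matrix k N) r → RowSpace X (X r)
  RowSpace-row X r = δ r , λ t → sym (sum-δ* r (λ j → X j t))

  RowSpace-⊆ : ∀ {k r N} (X : Matrix k N) (Y : Matrix r N) →
               (∀ j → RowSpace X (Y j)) → ∀ {v} → RowSpace Y v → RowSpace X v
  RowSpace-⊆ X Y Y⊆X (cs , v≈) = RowSpace-resp X (λ t → sym (v≈ t)) (RowSpace-lincomb X cs Y Y⊆X)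

  RowSpace-+ : ∀ {k N} (X : Matrix k N) {u v : Vec N} →
               RowSpace X u → RowSpace X v → RowSpace X (λ t → u t + v t)
  RowSpace-+ X (cs , u≈) (ds , v≈) =
    (λ j → cs j + ds j) , λ t → trans (+-cong (u≈ t) (v≈ t)) (sym (lincomb-+ cs ds X t))

  RowSpace-0 : ∀ {k N} (X : Matrix k N) → RowSpace X 0ᵛ
  RowSpace-0 X = (λ _ → 0#) , λ t → sym (lincomb-zeroˡ X (λ _ → refl) t)

  RowSpace-++ˡ : ∀ {m n N} (X : Matrix m N) (Y : Matrix n N) {v} → RowSpace X v → RowSpace (X ++ Y) v
  RowSpace-++ˡ {n = n} X Y = RowSpace-⊆ (X ++ Y) X
    (λ j → P.subst (RowSpace (X ++ Y)) (lookup-++ˡ X Y j) (RowSpace-row (X ++ Y) (j ↑ˡ n)))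

  RowSpace-++ʳ : ∀ {m n N} (X : Matrix m N) (Y : Matrix n N) {v} → RowSpace Y v → RowSpace (X ++ Y) v
  RowSpace-++ʳ {m} X Y = RowSpace-⊆ (X ++ Y) Y
    (λ j → P.subst (RowSpace (X ++ Y)) (lookup-++ʳ X Y j) (RowSpace-row (X ++ Y) (m ↑ʳ j)))

  +ₛ⇒RowSpace-++ : ∀ {m n N} (X : Matrix m N) (Y : Matrix n N) {v} →
                   (RowSpace X +ₛ RowSpace Y) v → RowSpace (X ++ Y) v
  +ₛ⇒RowSpace-++ X Y (u , w , (cs , u≈) , (ds , w≈) , v≈) =
    cs ++ ds , λ t → trans (v≈ t) (trans (+-cong (u≈ t) (w≈ t)) (sym (lincomb-++ cs ds X Y t)))

  RowSpace-++⇒+ₛ : ∀ {m n N} (X : Matrix m N) (Y : Matrix n N) {v} →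
                   RowSpace (X ++ Y) v → (RowSpace X +ₛ RowSpace Y) v
  RowSpace-++⇒+ₛ {m} {n} X Y (γ , v≈) =
    lincomb (γ ∘ (_↑ˡ n)) X , lincomb (γ ∘ (m ↑ʳ_)) Y , (_ , λ _ → refl) , (_ , λ _ → refl) ,
    λ t → trans (v≈ t) (lincomb-++ᵛ γ X Y t)

  RowSpace⊆+ₛˡ : ∀ {k m N} (X : Matrix k N) (Y : Matrix m N) {v} → RowSpace X v → (RowSpace X +ₛ RowSpace Y) v
  RowSpace⊆+ₛˡ X Y v∈X = _ , 0ᵛ , v∈X , RowSpace-0 Y , λ _ → sym (+-identityʳ _)

  RowSpace⊆+ₛʳ : ∀ {k m N} (X : Matrix k N) (Y : Matrix m N) {v} → RowSpace Y v → (RowSpace X +ₛ RowSpace Y) v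
  RowSpace⊆+ₛʳ X Y v∈Y = 0ᵛ , _ , RowSpace-0 X , v∈Y , λ _ → sym (+-identityˡ _)

  +ₛ-comm : ∀ {N} (U W : Subset N) {v} → (U +ₛ W) v → (W +ₛ U) v
  +ₛ-comm U W (u , w , u∈U , w∈W , v≈) = w , u , w∈W , u∈U , λ t → trans (v≈ t) (+-comm _ _)

  LinIndep-resp : ∀ {r N} {vs ws : Fin r → Vec N} → (∀ j → vs j ≋ ws j) → LinIndep vs → LinIndep ws
  LinIndep-resp vs≋ws vs-indep cs ws-comb≈0 =
    vs-indep cs (λ t → trans (lincomb-cong (λ _ → refl) vs≋ws t) (ws-comb≈0 t))

  LinIndep-↑ˡ : ∀ {m n N} (vs : Fin (m ℕ.+ n) → Vec N) → LinIndep vs → LinIndep (vs ∘ (_↑ˡ n))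
  LinIndep-↑ˡ {m} {n} vs vs-indep cs comb≈0 j =
    trans (reflexive (P.sym (lookup-++ˡ cs 0s j))) (vs-indep (cs ++ 0s) padded≈0 (j ↑ˡ n))
    where
    0s : Fin n → Carrier
    0s _ = 0#
    padded≈0 : ∀ t → lincomb (cs ++ 0s) vs t ≈ 0#
    padded≈0 t = begin
      lincomb (cs ++ 0s) vs t                                              ≈⟨ lincomb-split {m} {n} (cs ++ 0s) vs t ⟩
      lincomb ((cs ++ 0s) ∘ (_↑ˡ n)) (vs ∘ (_↑ˡ n)) t + lincomb ((cs ++ 0s) ∘ (m ↑ʳ_)) (vs ∘ (m ↑ʳ_)) t
        ≈⟨ +-cong (lincomb-congˡ (vs ∘ (_↑ˡ n)) (λ j → reflexive (lookup-++ˡ cs 0s j)) t)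
                  (lincomb-zeroˡ (vs ∘ (m ↑ʳ_)) (λ j → reflexive (lookup-++ʳ cs 0s j)) t) ⟩
      lincomb cs (vs ∘ (_↑ˡ n)) t + 0#                                     ≈⟨ +-identityʳ _ ⟩
      lincomb cs (vs ∘ (_↑ˡ n)) t                                          ≈⟨ comb≈0 t ⟩
      0#                                                                   ∎

  LinIndep-++ : ∀ {p q n N} (vs : Fin p → Vec N) (ws : Fin q → Vec N) (τ : Fin n → Fin N) →
                LinIndep vs → (∀ j t → vs j (τ t) ≈ 0#) → LinIndep (λ j → ws j ∘ τ) → LinIndep (vs ++ ws)
  LinIndep-++ {p} {q} vs ws τ vs-indep vs∘τ≈0 ws∘τ-indep γ comb≈0 = ∀-split γˡ≈0 γʳ≈0
    where
    γˡ : Fin p → Carrier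
    γˡ = γ ∘ (_↑ˡ q)
    γʳ : Fin q → Carrier
    γʳ = γ ∘ (p ↑ʳ_)
    split≈0 : ∀ t → lincomb γˡ vs t + lincomb γʳ ws t ≈ 0#
    split≈0 t = trans (sym (lincomb-++ᵛ γ vs ws t)) (comb≈0 t)
    γʳ≈0 : ∀ j → γʳ j ≈ 0#
    γʳ≈0 = ws∘τ-indep γʳ λ t → begin
      lincomb γʳ ws (τ t)                           ≈⟨ +-identityˡ _ ⟨
      0# + lincomb γʳ ws (τ t)                      ≈⟨ +-congʳ (lincomb-zeroʳ γˡ vs∘τ≈0 t) ⟨
      lincomb γˡ vs (τ t) + lincomb γʳ ws (τ t)     ≈⟨ split≈0 (τ t) ⟩
      0#                                            ∎
    γˡ≈0 : ∀ j → γˡ j ≈ 0#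
    γˡ≈0 = vs-indep γˡ λ t → begin
      lincomb γˡ vs t                               ≈⟨ +-identityʳ _ ⟨
      lincomb γˡ vs t + 0#                          ≈⟨ +-congˡ (lincomb-zeroˡ ws γʳ≈0 t) ⟨
      lincomb γˡ vs t + lincomb γʳ ws t             ≈⟨ split≈0 t ⟩
      0#                                            ∎

  record IsBlock {k N n} (X : Matrix k N) (τ : Fin n → Fin N) (A : Matrix k n) : Set c where
    constructor block
    field columns : ∀ r t → X r (τ t) ≡ A r t

  lincomb-block : ∀ {k N n} {X : Matrix k N} {τ : Fin n → Fin N} {A : Matrix k n} →
                  IsBlock X τ A → ∀ cs t → lincomb cs X (τ t) ≈ lincomb cs A t
  lincomb-block {k} (block X∘τ≡A) cs t = sum-cong-≋ {k} (λ r → reflexive (P.cong (cs r *_) (X∘τ≡A r t)))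

  RowSpace-block : ∀ {k N n} {X : Matrix k N} {τ : Fin n → Fin N} {A : Matrix k n} →
                   IsBlock X τ A → ∀ {v} → RowSpace X v → RowSpace A (v ∘ τ)
  RowSpace-block {τ = τ} X∘τ≡A (cs , v≈) = cs , λ t → trans (v≈ (τ t)) (lincomb-block X∘τ≡A cs t)

  LinIndep-lift : ∀ {s n N} (vs : Fin s → Vec N) (τ : Fin n → Fin N) {ys : Fin s → Vec n} →
                  (∀ j → (vs j ∘ τ) ≋ ys j) → LinIndep ys → LinIndep vs
  LinIndep-lift vs τ vs∘τ≋ys ys-indep γ comb≈0 =
    ys-indep γ (λ t → trans (sym (lincomb-cong (λ _ → refl) vs∘τ≋ys t)) (comb≈0 (τ t)))

  lift-RowSpace : ∀ {k N n} {X : Matrix k N} {τ : Fin n → Fin N} {A : Matrix k n} → IsBlock X τ A →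
                  ∀ {y} → RowSpace A y → ∃[ ŷ ] (RowSpace X ŷ × (ŷ ∘ τ) ≋ y)
  lift-RowSpace {X = X} X∘τ≡A (cs , y≈) =
    lincomb cs X , (cs , λ _ → refl) , λ t → trans (lincomb-block X∘τ≡A cs t) (sym (y≈ t))

  lift-+ₛ : ∀ {k N n} {X Y : Matrix k N} {τ : Fin n → Fin N} {A B : Matrix k n} →
            IsBlock X τ A → IsBlock Y τ B →
            ∀ {y} → (RowSpace A +ₛ RowSpace B) y → ∃[ ŷ ] ((RowSpace X +ₛ RowSpace Y) ŷ × (ŷ ∘ τ) ≋ y)
  lift-+ₛ X∘τ≡A Y∘τ≡B (u , w , u∈A , w∈B , y≈) with lift-RowSpace X∘τ≡A u∈A | lift-RowSpace Y∘τ≡B w∈B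
  ... | û , û∈X , û∘τ≋u | ŵ , ŵ∈Y , ŵ∘τ≋w =
    (λ t → û t + ŵ t) , (û , ŵ , û∈X , ŵ∈Y , λ _ → refl) ,
    λ t → trans (+-cong (û∘τ≋u t) (ŵ∘τ≋w t)) (sym (y≈ t))

  RestrictionKernel : ∀ {k N n} → Matrix k N → (Fin n → Fin N) → Subset N
  RestrictionKernel X τ v = RowSpace X v × (∀ t → v (τ t) ≈ 0#)

  blockColumn : ∀ M (n : Fin M → ℕ) (i : Fin M) → Fin (n i) → Fin (total M n)
  blockColumn (suc M) n F.zero t = t ↑ˡ total M (n ∘ F.suc)
  blockColumn (suc M) n (F.suc i) t = n F.zero ↑ʳ blockColumn M (n ∘ F.suc) i t

  concat-IsBlock : ∀ {k} M n (A : (i : Fin M) → Matrix k (n i)) i →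
                   IsBlock (concat M n A) (blockColumn M n i) (A i)
  concat-IsBlock M n A i = block (columns M n A i)
    where
    columns : ∀ {k} M n (A : (i : Fin M) → Matrix k (n i)) i r t →
              concat M n A r (blockColumn M n i t) ≡ A i r t
    columns (suc M) n A F.zero r t rewrite FP.splitAt-↑ˡ (n F.zero) t (total M (n ∘ F.suc)) = P.refl
    columns (suc M) n A (F.suc i) r t
      rewrite FP.splitAt-↑ʳ (n F.zero) (total M (n ∘ F.suc)) (blockColumn M (n ∘ F.suc) i t) =
      columns M (n ∘ F.suc) (A ∘ F.suc) i r t

  otherColumn : ∀ M (n : Fin (suc M) → ℕ) (i : Fin (suc M)) →
                Fin (total M (n ∘ F.punchIn i)) → Fin (total (suc M) n)
  otherColumn M n F.zero t = n F.zero ↑ʳ t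
  otherColumn (suc M) n (F.suc i) t =
    [ _↑ˡ total (suc M) (n ∘ F.suc) , (λ t → n F.zero ↑ʳ otherColumn M (n ∘ F.suc) i t) ] (splitAt (n F.zero) t)

  concatWithout-IsBlock : ∀ {k} M n (A : (i : Fin (suc M)) → Matrix k (n i)) i →
                          IsBlock (concat (suc M) n A) (otherColumn M n i) (concatWithout M n i A)
  concatWithout-IsBlock M n A i = block (columns M n A i)
    where
    columns : ∀ {k} M n (A : (i : Fin (suc M)) → Matrix k (n i)) i r t →
              concat (suc M) n A r (otherColumn M n i t) ≡ concatWithout M n i A r t
    columns M n A F.zero r t rewrite FP.splitAt-↑ʳ (n F.zero) (total M (n ∘ F.suc)) t = P.refl
    columns (suc M) n A (F.suc i) r t with splitAt (n F.zero) t
    ... | inj₁ t₁ rewrite FP.splitAt-↑ˡ (n F.zero) t₁ (total (suc M) (n ∘ F.suc)) = P.refl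
    ... | inj₂ t₂ rewrite FP.splitAt-↑ʳ (n F.zero) (total (suc M) (n ∘ F.suc)) (otherColumn M (n ∘ F.suc) i t₂) =
      columns M (n ∘ F.suc) (A ∘ F.suc) i r t₂

module Dimension {c ℓ : Level} (F : Field c ℓ) (_≈?_ : Decidable (Field._≈_ F)) where
  open Field F
  open LinAlg F
  open SpanProperties F
  open SemiringSum semiring using (sum; sum-cong-≋; sum-remove; *-distribʳ-sum)
  open RingProperties ring using (-‿distribˡ-*; -‿distribʳ-*)
  open import Algebra.Properties.AbelianGroup +-abelianGroup using (⁻¹-∙-comm)
  open import Algebra.Properties.Group +-group using (inverseˡ-unique)
  open import Algebra.Solver.CommutativeMonoid +-commutativeMonoid using (solve; _⊕_; _⊜_)
  open import Relation.Binary.Reasoning.Setoid setoid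

  LinIndep⇒nonzero : ∀ {s N} (vs : Fin s → Vec N) → LinIndep vs → ∀ j → ¬ (vs j ≋ 0ᵛ)
  LinIndep⇒nonzero vs vs-indep j vs-j≋0 =
    1≉0 (trans (sym (δ-diag j)) (vs-indep (δ j) (λ t → trans (sum-δ* j (λ l → vs l t)) (vs-j≋0 t)) j))

  [x+y]-[x+z]≈y-z : ∀ x y z → (x + y) - (x + z) ≈ y - z
  [x+y]-[x+z]≈y-z x y z = begin
    (x + y) + - (x + z)      ≈⟨ +-congˡ (⁻¹-∙-comm x z) ⟨
    (x + y) + (- x + - z)
      ≈⟨ solve 4 (λ x y x' z' → (x ⊕ y) ⊕ (x' ⊕ z') ⊜ (x ⊕ x') ⊕ (y ⊕ z')) refl x y (- x) (- z) ⟩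
    (x + - x) + (y + - z)    ≈⟨ +-congʳ (-‿inverseʳ x) ⟩
    0# + (y - z)             ≈⟨ +-identityˡ _ ⟩
    y - z                    ∎

  -- One exchange step: since the l₀-th coefficient of vs zero is invertible, subtracting suitable
  -- multiples of vs zero from the other vectors removes ws l₀ from their expansions.
  module SteinitzStep {s t N} (vs : Fin (suc s) → Vec N) (ws : Fin (suc t) → Vec N)
         (C : Fin (suc s) → Fin (suc t) → Carrier) (vs≋ : ∀ j → vs j ≋ lincomb (C j) ws)
         (l₀ : Fin (suc t)) (c⁻¹ : Carrier) (cc⁻¹≈1 : C F.zero l₀ * c⁻¹ ≈ 1#) where

    κ : Fin s → Carrier
    κ j = C (F.suc j) l₀ * c⁻¹

    κc≈C : ∀ j → κ j * C F.zero l₀ ≈ C (F.suc j) l₀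
    κc≈C j = trans (*-assoc _ _ _) (trans (*-congˡ (trans (*-comm c⁻¹ _) cc⁻¹≈1)) (*-identityʳ _))

    ws' : Fin t → Vec N
    ws' = ws ∘ F.punchIn l₀

    vs' : Fin s → Vec N
    vs' j p = vs (F.suc j) p - κ j * vs F.zero p

    C' : Fin s → Fin t → Carrier
    C' j l = C (F.suc j) (F.punchIn l₀ l) - κ j * C F.zero (F.punchIn l₀ l)

    expand : ∀ j p → vs j p ≈ C j l₀ * ws l₀ p + lincomb (C j ∘ F.punchIn l₀) ws' p
    expand j p = trans (vs≋ j p) (sum-remove {i = l₀} (λ l → C j l * ws l p))

    vs'≋ : ∀ j → vs' j ≋ lincomb (C' j) ws'
    vs'≋ j p = begin
      vs (F.suc j) p - κ j * vs F.zero p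
        ≈⟨ +-cong (expand (F.suc j) p) (-‿cong (*-congˡ (expand F.zero p))) ⟩
      (C (F.suc j) l₀ * w + Sⱼ) - κ j * (C F.zero l₀ * w + S₀)
        ≈⟨ +-congˡ (-‿cong (trans (distribˡ _ _ _) (+-congʳ (trans (sym (*-assoc _ _ _)) (*-congʳ (κc≈C j)))))) ⟩
      (C (F.suc j) l₀ * w + Sⱼ) - (C (F.suc j) l₀ * w + κ j * S₀)
        ≈⟨ [x+y]-[x+z]≈y-z _ _ _ ⟩
      Sⱼ - κ j * S₀
        ≈⟨ +-congˡ (-‿cong (lincomb-* (κ j) (C F.zero ∘ F.punchIn l₀) ws' p)) ⟨
      Sⱼ - lincomb (λ l → κ j * C F.zero (F.punchIn l₀ l)) ws' p
        ≈⟨ +-congˡ (lincomb-neg (λ l → κ j * C F.zero (F.punchIn l₀ l)) ws' p) ⟨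
      Sⱼ + lincomb (λ l → - (κ j * C F.zero (F.punchIn l₀ l))) ws' p
        ≈⟨ lincomb-+ (C (F.suc j) ∘ F.punchIn l₀) (λ l → - (κ j * C F.zero (F.punchIn l₀ l))) ws' p ⟨
      lincomb (C' j) ws' p ∎
      where
      w Sⱼ S₀ : Carrier
      w = ws l₀ p
      Sⱼ = lincomb (C (F.suc j) ∘ F.punchIn l₀) ws' p
      S₀ = lincomb (C F.zero ∘ F.punchIn l₀) ws' p

    vs'-indep : LinIndep vs → LinIndep vs'
    vs'-indep vs-indep α comb≈0 j = vs-indep β (λ p → trans (β-comb≈ p) (comb≈0 p)) (F.suc j)
      where
      K : Carrier
      K = sum (λ j → α j * κ j)
      β : Fin (suc s) → Carrier
      β = (- K) ∷ α
      β-comb≈ : ∀ p → lincomb β vs p ≈ lincomb α vs' p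
      β-comb≈ p = begin
        - K * vs F.zero p + Sα              ≈⟨ +-congʳ (-‿distribˡ-* K (vs F.zero p)) ⟨
        - (K * vs F.zero p) + Sα            ≈⟨ +-comm _ _ ⟩
        Sα - K * vs F.zero p                ≈⟨ +-congˡ (-‿cong (*-distribʳ-sum (vs F.zero p) (λ j → α j * κ j))) ⟩
        Sα - sum (λ j → α j * κ j * vs F.zero p)
          ≈⟨ +-congˡ (-‿cong (sum-cong-≋ {s} (λ j → *-assoc _ _ _))) ⟩
        Sα - lincomb α (λ j p → κ j * vs F.zero p) p
          ≈⟨ lincomb--ₘ α (vs ∘ F.suc) (λ j p → κ j * vs F.zero p) p ⟨
        lincomb α vs' p                     ∎
        where
        Sα : Carrier
        Sα = lincomb α (vs ∘ F.suc) p

  steinitz : ∀ t {s N} (vs : Fin s → Vec N) (ws : Fin t → Vec N) (C : Fin s → Fin t → Carrier) →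
             LinIndep vs → (∀ j → vs j ≋ lincomb (C j) ws) → s ≤ t
  steinitz t {ℕ.zero} vs ws C vs-indep vs≋ = ℕ.z≤n
  steinitz ℕ.zero {suc s} vs ws C vs-indep vs≋ = ⊥-elim (LinIndep⇒nonzero vs vs-indep F.zero (vs≋ F.zero))
  steinitz (suc t) {suc s} vs ws C vs-indep vs≋ with FP.any? (λ l → ¬? (C F.zero l ≈? 0#))
  ... | no all≈0 = ⊥-elim (LinIndep⇒nonzero vs vs-indep F.zero (λ p → trans (vs≋ F.zero p) (lincomb-zeroˡ ws C₀≈0 p)))
    where
    C₀≈0 : ∀ l → C F.zero l ≈ 0#
    C₀≈0 l = decidable-stable (C F.zero l ≈? 0#) (λ l≉0 → all≈0 (l , l≉0))
  ... | yes (l₀ , c≉0) with inverse (C F.zero l₀) c≉0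
  ... | c⁻¹ , cc⁻¹≈1 = ℕ.s≤s (steinitz t vs' ws' C' (vs'-indep vs-indep) vs'≋)
    where open SteinitzStep vs ws C vs≋ l₀ c⁻¹ cc⁻¹≈1

  independent≤spanning : ∀ {s t N} (vs : Fin s → Vec N) (ws : Fin t → Vec N) →
                         LinIndep vs → (∀ j → RowSpace ws (vs j)) → s ≤ t
  independent≤spanning vs ws vs-indep vs∈ws =
    steinitz _ vs ws (proj₁ ∘ vs∈ws) vs-indep (λ j t → proj₂ (vs∈ws j) t)

  Basis : ∀ {r N} → Subset N → (Fin r → Vec N) → Set (c ⊔ ℓ)
  Basis S b = LinIndep b × (∀ j → S (b j)) × (∀ v → S v → RowSpace b v)

  Basis⇒Dim : ∀ {r N} {S : Subset N} {b : Fin r → Vec N} → Basis S b → Dim S r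
  Basis⇒Dim {b = b} (b-indep , b∈S , S⊆b) = (b , b∈S , b-indep) , λ vs vs∈S vs-indep →
    ℕP.<-irrefl P.refl (independent≤spanning vs b vs-indep (λ j → S⊆b (vs j) (vs∈S j)))

  independent≤Dim : ∀ {N a s} (S : Subset N) → Dim S a →
                    (vs : Fin s → Vec N) → LinIndep vs → (∀ j → S (vs j)) → s ≤ a
  independent≤Dim {a = a} {s} S dim-S vs vs-indep vs∈S with s ℕ.≤? a
  ... | yes s≤a = s≤a
  ... | no s≰a with ℕP.m≤n⇒∃[o]m+o≡n (ℕP.≰⇒> s≰a)
  ... | o , P.refl = ⊥-elim (proj₂ dim-S (vs ∘ (_↑ˡ o)) (λ j → vs∈S (j ↑ˡ o)) (LinIndep-↑ˡ vs vs-indep))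

  Dim≤spanning : ∀ {N a t} {S : Subset N} → Dim S a → (ws : Fin t → Vec N) → (∀ v → S v → RowSpace ws v) → a ≤ t
  Dim≤spanning ((vs , vs∈S , vs-indep) , _) ws S⊆ws = independent≤spanning vs ws vs-indep (λ j → S⊆ws (vs j) (vs∈S j))

  Dim-unique : ∀ {N a b} {S : Subset N} → Dim S a → Dim S b → a ≡ b
  Dim-unique {S = S} dim-a@((vs , vs∈S , vs-indep) , _) dim-b@((ws , ws∈S , ws-indep) , _) =
    ℕP.≤-antisym (independent≤Dim S dim-b vs vs-indep vs∈S) (independent≤Dim S dim-a ws ws-indep ws∈S)

  independent≤ambient : ∀ {s N} (vs : Fin s → Vec N) → LinIndep vs → s ≤ N
  independent≤ambient vs vs-indep = independent≤spanning vs (λ i t → δ i t) vs-indep (λ j → vs j , λ t → sym (sum-*δ t (vs j)))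

  lincomb≈0⇒RowSpace-others : ∀ {k N} (M : Matrix (suc k) N) (α : Fin (suc k) → Carrier) j →
                              ¬ α j ≈ 0# → (∀ t → lincomb α M t ≈ 0#) → RowSpace (M ∘ F.punchIn j) (M j)
  lincomb≈0⇒RowSpace-others {N = N} M α j αⱼ≉0 comb≈0 with inverse (α j) αⱼ≉0
  ... | a⁻¹ , αⱼa⁻¹≈1 = (λ l → - a⁻¹ * α (F.punchIn j l)) , λ t → begin
    M j t                    ≈⟨ *-identityˡ _ ⟨
    1# * M j t               ≈⟨ *-congʳ (trans (*-comm _ _) αⱼa⁻¹≈1) ⟨
    (a⁻¹ * α j) * M j t      ≈⟨ *-assoc _ _ _ ⟩
    a⁻¹ * (α j * M j t)
      ≈⟨ *-congˡ (inverseˡ-unique _ (others t) (trans (sym (sum-remove {i = j} (λ l → α l * M l t))) (comb≈0 t))) ⟩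
    a⁻¹ * - others t         ≈⟨ -‿distribʳ-* _ _ ⟨
    - (a⁻¹ * others t)       ≈⟨ -‿distribˡ-* _ _ ⟩
    - a⁻¹ * others t         ≈⟨ lincomb-* (- a⁻¹) (α ∘ F.punchIn j) (M ∘ F.punchIn j) t ⟨
    lincomb (λ l → - a⁻¹ * α (F.punchIn j l)) (M ∘ F.punchIn j) t ∎
    where
    others : Vec N
    others = lincomb (α ∘ F.punchIn j) (M ∘ F.punchIn j)

  full-rank⇒LinIndep : ∀ {k N} (M : Matrix k N) → Rank M k → LinIndep M
  full-rank⇒LinIndep {suc k} M ((vs , vs∈M , vs-indep) , _) α comb≈0 j =
    decidable-stable (α j ≈? 0#) λ αⱼ≉0 → ℕP.<-irrefl P.refl
      (independent≤spanning vs (M ∘ F.punchIn j) vs-indep (λ l → RowSpace-⊆ _ M (rows∈others αⱼ≉0) (vs∈M l)))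
    where
    rows∈others : ¬ α j ≈ 0# → ∀ l → RowSpace (M ∘ F.punchIn j) (M l)
    rows∈others αⱼ≉0 l with l F.≟ j
    ... | yes P.refl = lincomb≈0⇒RowSpace-others M α j αⱼ≉0 comb≈0
    ... | no l≢j = P.subst (RowSpace (M ∘ F.punchIn j)) (P.cong M (FP.punchIn-punchOut (l≢j ∘ P.sym)))
                     (RowSpace-row (M ∘ F.punchIn j) (F.punchOut (l≢j ∘ P.sym)))

  LinIndep-∷ : ∀ {r N} {v : Vec N} {w : Fin r → Vec N} → LinIndep w → ¬ RowSpace w v → LinIndep (v ∷ w)
  LinIndep-∷ {v = v} {w} w-indep v∉w α comb≈0 = all≈0
    where
    α₀≈0 : α F.zero ≈ 0#
    α₀≈0 = decidable-stable (α F.zero ≈? 0#)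
      (λ α₀≉0 → v∉w (lincomb≈0⇒RowSpace-others (v ∷ w) α F.zero α₀≉0 comb≈0))
    all≈0 : ∀ j → α j ≈ 0#
    all≈0 F.zero = α₀≈0
    all≈0 (F.suc j) = w-indep (α ∘ F.suc) (λ t → begin
      lincomb (α ∘ F.suc) w t                    ≈⟨ +-identityˡ _ ⟨
      0# + lincomb (α ∘ F.suc) w t               ≈⟨ +-congʳ (trans (*-congʳ α₀≈0) (zeroˡ _)) ⟨
      α F.zero * v t + lincomb (α ∘ F.suc) w t   ≈⟨ comb≈0 t ⟩
      0#                                         ∎) j

  block-LinIndep : ∀ {k N n} {X : Matrix k N} {τ : Fin n → Fin N} {A : Matrix k n} → IsBlock X τ A → Rank A k →
                   ∀ {s} (vs : Fin s → Vec N) → LinIndep vs → (∀ j → RowSpace X (vs j)) → LinIndep (λ j → vs j ∘ τ)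
  block-LinIndep {X = X} {τ} {A} X∘τ≡A rank-A vs vs-indep vs∈X γ comb∘τ≈0
    with RowSpace-lincomb X γ vs vs∈X
  ... | β , β≈ = vs-indep γ (λ t → trans (β≈ t) (lincomb-zeroˡ X β≈0 t))
    where
    β≈0 : ∀ r → β r ≈ 0#
    β≈0 = full-rank⇒LinIndep A rank-A β
      (λ t → trans (sym (lincomb-block X∘τ≡A β t)) (trans (sym (β≈ (τ t))) (comb∘τ≈0 t)))

  module _ {k N n} {X Y : Matrix k N} {τ : Fin n → Fin N} {A B : Matrix k n}
           (X∘τ≡A : IsBlock X τ A) (Y∘τ≡B : IsBlock Y τ B) where

    dim[A+B]≤dim[X+Y] : ∀ {aᵢ a} → Dim (RowSpace A +ₛ RowSpace B) aᵢ → Dim (RowSpace X +ₛ RowSpace Y) a →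
                        aᵢ ≤ a
    dim[A+B]≤dim[X+Y] ((ys , ys∈ , ys-indep) , _) dim-X+Y =
      independent≤Dim (RowSpace X +ₛ RowSpace Y) dim-X+Y (proj₁ ∘ lift)
        (LinIndep-lift (proj₁ ∘ lift) τ (proj₂ ∘ proj₂ ∘ lift) ys-indep) (proj₁ ∘ proj₂ ∘ lift)
      where
      lift : ∀ j → ∃[ ŷ ] ((RowSpace X +ₛ RowSpace Y) ŷ × (ŷ ∘ τ) ≋ ys j)
      lift j = lift-+ₛ X∘τ≡A Y∘τ≡B (ys∈ j)

    dim[X∩Y]≤dim[A∩B] : Rank A k → ∀ {b bᵢ} → Dim (RowSpace X ∩ₛ RowSpace Y) b →
                        Dim (RowSpace A ∩ₛ RowSpace B) bᵢ → b ≤ bᵢ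
    dim[X∩Y]≤dim[A∩B] rank-A ((zs , zs∈ , zs-indep) , _) dim-A∩B =
      independent≤Dim (RowSpace A ∩ₛ RowSpace B) dim-A∩B (λ j → zs j ∘ τ)
        (block-LinIndep X∘τ≡A rank-A zs zs-indep (proj₁ ∘ zs∈))
        (λ j → RowSpace-block X∘τ≡A (proj₁ (zs∈ j)) , RowSpace-block Y∘τ≡B (proj₂ (zs∈ j)))

    dim[ker]+rank[B]≤dim[X+Y] : ∀ {κ rB a} {g : Fin κ → Vec N} → Basis (RestrictionKernel X τ) g → Rank B rB →
                                Dim (RowSpace X +ₛ RowSpace Y) a → κ ℕ.+ rB ≤ a
    dim[ker]+rank[B]≤dim[X+Y] {rB = rB} {g = g} (g-indep , g∈ker , _) ((bs , bs∈B , bs-indep) , _) dim-X+Y =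
      independent≤Dim (RowSpace X +ₛ RowSpace Y) dim-X+Y (g ++ ŵ)
        (LinIndep-++ g ŵ τ g-indep (proj₂ ∘ g∈ker) (LinIndep-resp (λ j t → sym (proj₂ (proj₂ (lift j)) t)) bs-indep))
        (∀-++ (RowSpace X +ₛ RowSpace Y) (RowSpace⊆+ₛˡ X Y ∘ proj₁ ∘ g∈ker)
                                         (RowSpace⊆+ₛʳ X Y ∘ proj₁ ∘ proj₂ ∘ lift))
      where
      lift : ∀ j → ∃[ ŵ ] (RowSpace Y ŵ × (ŵ ∘ τ) ≋ bs j)
      lift j = lift-RowSpace Y∘τ≡B (bs∈B j)
      ŵ : Fin rB → Vec N
      ŵ = proj₁ ∘ lift

    rank[X′-Y′]+k≤dim[X+Y] : ∀ {n′} {τ′ : Fin n′ → Fin N} {X′ Y′ : Matrix k n′} →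
                             IsBlock X τ′ X′ → IsBlock Y τ′ Y′ → (∀ r t → A r t ≈ B r t) → Rank A k → Rank X k →
                             ∀ {ρ a} → Rank (X′ -ₘ Y′) ρ → Dim (RowSpace X +ₛ RowSpace Y) a → ρ ℕ.+ k ≤ a
    rank[X′-Y′]+k≤dim[X+Y] {τ′ = τ′} {X′} {Y′} X∘τ′≡X′ Y∘τ′≡Y′ A≈B rank-A
                           ((us , us∈X , us-indep) , _) {ρ} ((es , es∈ , es-indep) , _) dim-X+Y =
      independent≤Dim (RowSpace X +ₛ RowSpace Y) dim-X+Y (ê ++ us)
        (LinIndep-++ ê us τ (LinIndep-lift ê τ′ ê∘τ′≋es es-indep) ê∘τ≈0
          (block-LinIndep X∘τ≡A rank-A us us-indep us∈X))
        (∀-++ (RowSpace X +ₛ RowSpace Y) ê∈X+Y (RowSpace⊆+ₛˡ X Y ∘ us∈X))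
      where
      cs : Fin ρ → Fin k → Carrier
      cs j = proj₁ (es∈ j)
      ê : Fin ρ → Vec N
      ê j t = lincomb (cs j) X t - lincomb (cs j) Y t
      ê∘τ≈0 : ∀ j t → ê j (τ t) ≈ 0#
      ê∘τ≈0 j t = begin
        lincomb (cs j) X (τ t) - lincomb (cs j) Y (τ t)
          ≈⟨ +-cong (lincomb-block X∘τ≡A (cs j) t) (-‿cong (lincomb-block Y∘τ≡B (cs j) t)) ⟩
        lincomb (cs j) A t - lincomb (cs j) B t
          ≈⟨ +-congˡ (-‿cong (lincomb-cong (λ _ → refl) (λ r t → sym (A≈B r t)) t)) ⟩
        lincomb (cs j) A t - lincomb (cs j) A t         ≈⟨ -‿inverseʳ _ ⟩
        0#                                              ∎
      ê∘τ′≋es : ∀ j → (ê j ∘ τ′) ≋ es j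
      ê∘τ′≋es j t = begin
        lincomb (cs j) X (τ′ t) - lincomb (cs j) Y (τ′ t)
          ≈⟨ +-cong (lincomb-block X∘τ′≡X′ (cs j) t) (-‿cong (lincomb-block Y∘τ′≡Y′ (cs j) t)) ⟩
        lincomb (cs j) X′ t - lincomb (cs j) Y′ t         ≈⟨ lincomb--ₘ (cs j) X′ Y′ t ⟨
        lincomb (cs j) (X′ -ₘ Y′) t                       ≈⟨ proj₂ (es∈ j) t ⟨
        es j t                                            ∎
      ê∈X+Y : ∀ j → (RowSpace X +ₛ RowSpace Y) (ê j)
      ê∈X+Y j = lincomb (cs j) X , (λ t → - lincomb (cs j) Y t) , (cs j , λ _ → refl) ,
                ((λ r → - cs j r) , λ t → sym (lincomb-neg (cs j) Y t)) , λ _ → refl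

-- Over a finite field, membership in a row space is decidable by exhaustive search over coefficient
-- vectors; this is what allows independent families to be extended to bases.
module FiniteDimension {c ℓ : Level} (Fq : FiniteField c ℓ) where
  open FiniteField Fq
  open LinAlg field'
  open SpanProperties field'
  open import Relation.Binary.Reasoning.Setoid setoid

  _≈?_ : Decidable _≈_
  x ≈? y with enum-surj x | enum-surj y
  ... | i , eᵢ≈x | j , eⱼ≈y with i F.≟ j
  ... | yes P.refl = yes (trans (sym eᵢ≈x) eⱼ≈y)
  ... | no i≢j = no λ x≈y → i≢j (enum-inj i j (trans eᵢ≈x (trans x≈y (sym eⱼ≈y))))

  open Dimension field' _≈?_

  Resp : ∀ {p N} → (Vec N → Set p) → Set (p ⊔ c ⊔ ℓ)
  Resp Q = ∀ {u v} → u ≋ v → Q u → Q v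

  any-scalar? : ∀ {p} {Q : Carrier → Set p} → (∀ {x y} → x ≈ y → Q x → Q y) → (∀ x → Dec (Q x)) →
                Dec (∃[ x ] Q x)
  any-scalar? Q-resp Q? with FP.any? (Q? ∘ enum)
  ... | yes (i , Qeᵢ) = yes (enum i , Qeᵢ)
  ... | no ¬Qe = no λ (x , Qx) → ¬Qe (proj₁ (enum-surj x) , Q-resp (sym (proj₂ (enum-surj x))) Qx)

  any-vector? : ∀ {p} N {Q : Vec N → Set p} → Resp Q → (∀ v → Dec (Q v)) → Dec (∃[ v ] Q v)
  any-vector? ℕ.zero Q-resp Q? with Q? (λ ())
  ... | yes Q[] = yes (_ , Q[])
  ... | no ¬Q[] = no λ (v , Qv) → ¬Q[] (Q-resp (λ ()) Qv)
  any-vector? (suc N) {Q} Q-resp Q? with any-scalar? head-resp (λ x → any-vector? N (tail-resp x) (λ w → Q? (x ∷ w)))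
    where
    head-resp : ∀ {x y} → x ≈ y → ∃[ w ] Q (x ∷ w) → ∃[ w ] Q (y ∷ w)
    head-resp x≈y (w , Q[x∷w]) = w , Q-resp (λ { F.zero → x≈y ; (F.suc i) → refl }) Q[x∷w]
    tail-resp : ∀ x → Resp (λ w → Q (x ∷ w))
    tail-resp x w≋w' = Q-resp (λ { F.zero → refl ; (F.suc i) → w≋w' i })
  ... | yes (x , w , Q[x∷w]) = yes (x ∷ w , Q[x∷w])
  ... | no ¬Q∷ = no λ (v , Qv) → ¬Q∷ (v F.zero , v ∘ F.suc , Q-resp (λ { F.zero → refl ; (F.suc i) → refl }) Qv)

  RowSpace? : ∀ {k N} (X : Matrix k N) v → Dec (RowSpace X v)
  RowSpace? {k} X v = any-vector? k
    (λ cs≋ds v≈ t → trans (v≈ t) (lincomb-congˡ X cs≋ds t))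
    (λ cs → FP.all? (λ t → v t ≈? lincomb cs X t))

  extend-to-basis : ∀ {s N} (S : Subset N) → Resp S → (∀ v → Dec (S v)) →
                    (z : Fin s → Vec N) → LinIndep z → (∀ j → S (z j)) →
                    ∃[ e ] Σ (Fin e → Vec N) λ u → Basis S (u ++ z)
  extend-to-basis {s} {N} S S-resp S? z z-indep z∈S = grow (suc N) 0 (λ ()) z-indep z∈S (ℕP.m≤m+n (suc N) s)
    where
    -- fuel + (e + s) stays above N, while an independent family in F^N has at most N members
    grow : ∀ fuel e (u : Fin e → Vec N) → LinIndep (u ++ z) → (∀ j → S ((u ++ z) j)) →
           N ℕ.< fuel ℕ.+ (e ℕ.+ s) → ∃[ e ] Σ (Fin e → Vec N) λ u → Basis S (u ++ z)
    grow ℕ.zero e u indep _ N<e+s = ⊥-elim (ℕP.<⇒≱ N<e+s (independent≤ambient (u ++ z) indep))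
    grow (suc fuel) e u indep ∈S bound
      with any-vector? N {λ v → S v × ¬ RowSpace (u ++ z) v}
             (λ v≋w (v∈S , v∉) → S-resp v≋w v∈S , v∉ ∘ RowSpace-resp (u ++ z) (λ t → sym (v≋w t)))
             (λ v → S? v ×-dec ¬? (RowSpace? (u ++ z) v))
    ... | no none = e , u , indep , ∈S , λ v v∈S → decidable-stable (RowSpace? (u ++ z) v) (λ v∉ → none (v , v∈S , v∉))
    ... | yes (v , v∈S , v∉) = grow fuel (suc e) (v ∷ u)
          (LinIndep-resp (λ j t → reflexive (P.cong (λ w → w t) (∷-++ v u z j))) (LinIndep-∷ indep v∉))
          (λ j → P.subst S (∷-++ v u z j) (∈S∷ j))
          (P.subst (N ℕ.<_) (P.sym (ℕP.+-suc fuel (e ℕ.+ s))) bound)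
      where
      ∈S∷ : ∀ j → S ((v ∷ (u ++ z)) j)
      ∈S∷ F.zero = v∈S
      ∈S∷ (F.suc j) = ∈S j

  basis-exists : ∀ {N} (S : Subset N) → Resp S → (∀ v → Dec (S v)) → ∃[ r ] Σ (Fin r → Vec N) (Basis S)
  basis-exists S S-resp S? with extend-to-basis {0} S S-resp S? (λ ()) (λ _ _ ()) (λ ())
  ... | e , u , basis = _ , u ++ (λ ()) , basis

  +ₛ-resp : ∀ {N} (U W : Subset N) → Resp (U +ₛ W)
  +ₛ-resp U W v≋w (x , y , x∈U , y∈W , v≈) = x , y , x∈U , y∈W , λ t → trans (sym (v≋w t)) (v≈ t)

  grassmann : ∀ {k m N p q} (X : Matrix k N) (Y : Matrix m N) → Dim (RowSpace X) p → Dim (RowSpace Y) q →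
              ∃[ a ] ∃[ b ] (Dim (RowSpace X +ₛ RowSpace Y) a × Dim (RowSpace X ∩ₛ RowSpace Y) b ×
                             a ℕ.+ b ≤ p ℕ.+ q)
  grassmann {N = N} X Y dim-X dim-Y
    with basis-exists (RowSpace X ∩ₛ RowSpace Y)
           (λ u≋v (u∈X , u∈Y) → RowSpace-resp X u≋v u∈X , RowSpace-resp Y u≋v u∈Y)
           (λ v → RowSpace? X v ×-dec RowSpace? Y v)
  ... | b , z , z-basis@(z-indep , z∈X∩Y , _)
    with extend-to-basis (RowSpace X) (RowSpace-resp X) (RowSpace? X) z z-indep (proj₁ ∘ z∈X∩Y)
       | extend-to-basis (RowSpace Y) (RowSpace-resp Y) (RowSpace? Y) z z-indep (proj₂ ∘ z∈X∩Y)
       | basis-exists (RowSpace X +ₛ RowSpace Y) (+ₛ-resp (RowSpace X) (RowSpace Y))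
           (λ v → map′ (RowSpace-++⇒+ₛ X Y) (+ₛ⇒RowSpace-++ X Y) (RowSpace? (X ++ Y) v))
  ... | e₁ , u₁ , X-basis@(_ , _ , X⊆u₁z) | e₂ , u₂ , Y-basis@(_ , _ , Y⊆u₂z) | a , _ , X+Y-basis =
    a , b , Basis⇒Dim X+Y-basis , Basis⇒Dim z-basis ,
    grassmann-count (Dim≤spanning (Basis⇒Dim X+Y-basis) G X+Y⊆G)
      (Dim-unique {S = RowSpace X} (Basis⇒Dim X-basis) dim-X) (Dim-unique {S = RowSpace Y} (Basis⇒Dim Y-basis) dim-Y)
    where
    G : Fin (e₁ ℕ.+ (e₂ ℕ.+ b)) → Vec N
    G = u₁ ++ (u₂ ++ z)
    u₁z⊆G : ∀ j → RowSpace G ((u₁ ++ z) j)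
    u₁z⊆G = ∀-++ (RowSpace G) (λ j → RowSpace-++ˡ u₁ (u₂ ++ z) (RowSpace-row u₁ j))
                              (λ j → RowSpace-++ʳ u₁ (u₂ ++ z) (RowSpace-++ʳ u₂ z (RowSpace-row z j)))
    X+Y⊆G : ∀ v → (RowSpace X +ₛ RowSpace Y) v → RowSpace G v
    X+Y⊆G v (x , y , x∈X , y∈Y , v≈) = RowSpace-resp G (λ t → sym (v≈ t))
      (RowSpace-+ G (RowSpace-⊆ G (u₁ ++ z) u₁z⊆G (X⊆u₁z x x∈X)) (RowSpace-++ʳ u₁ (u₂ ++ z) (Y⊆u₂z y y∈Y)))

  rank[X]≤rank[A]+dim[ker] : ∀ {k N n} {X : Matrix k N} {τ : Fin n → Fin N} {A : Matrix k n} → IsBlock X τ A →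
                             Rank X k → ∀ {rA κ} {g : Fin κ → Vec N} → Rank A rA → Basis (RestrictionKernel X τ) g →
                             k ≤ rA ℕ.+ κ
  rank[X]≤rank[A]+dim[ker] {X = X} {τ} {A} X∘τ≡A rank-X {κ = κ} {g} rank-A (g-indep , g∈ker , ker⊆g)
    with extend-to-basis (RowSpace X) (RowSpace-resp X) (RowSpace? X) g g-indep (proj₁ ∘ g∈ker)
  ... | e , u , X-basis@(ug-indep , ug∈X , _) =
    P.subst (_≤ _) (Dim-unique {S = RowSpace X} (Basis⇒Dim X-basis) rank-X)
      (ℕP.+-monoˡ-≤ κ (independent≤Dim (RowSpace A) rank-A (λ j → u j ∘ τ) u∘τ-indep
                                       (λ j → RowSpace-block X∘τ≡A (u∈X j))))
    where
    u∈X : ∀ j → RowSpace X (u j)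
    u∈X j = P.subst (RowSpace X) (lookup-++ˡ u g j) (ug∈X (j ↑ˡ κ))
    -- a combination of u vanishing on τ lies in the span of g, which together with u is independent
    u∘τ-indep : LinIndep (λ j → u j ∘ τ)
    u∘τ-indep γ comb≈0 j with ker⊆g (lincomb γ u) (RowSpace-lincomb X γ u u∈X , comb≈0)
    ... | μ , comb≈μg = trans (reflexive (P.sym (lookup-++ˡ γ (λ l → - μ l) j))) (ug-indep ν ν-comb≈0 (j ↑ˡ κ))
      where
      ν : Fin (e ℕ.+ κ) → Carrier
      ν = γ ++ (λ l → - μ l)
      ν-comb≈0 : ∀ t → lincomb ν (u ++ g) t ≈ 0#
      ν-comb≈0 t = begin
        lincomb ν (u ++ g) t                        ≈⟨ lincomb-++ γ (λ l → - μ l) u g t ⟩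
        lincomb γ u t + lincomb (λ l → - μ l) g t   ≈⟨ +-congˡ (lincomb-neg μ g t) ⟩
        lincomb γ u t - lincomb μ g t               ≈⟨ +-congˡ (-‿cong (comb≈μg t)) ⟨
        lincomb γ u t - lincomb γ u t               ≈⟨ -‿inverseʳ _ ⟩
        0#                                          ∎

  k+rank[B]≤dim[X+Y]+rank[A] : ∀ {k N n} {X Y : Matrix k N} {τ : Fin n → Fin N} {A B : Matrix k n} →
                               IsBlock X τ A → IsBlock Y τ B → Rank X k → ∀ {rA rB a} → Rank A rA → Rank B rB →
                               Dim (RowSpace X +ₛ RowSpace Y) a → k ℕ.+ rB ≤ a ℕ.+ rA
  k+rank[B]≤dim[X+Y]+rank[A] {X = X} {τ = τ} X∘τ≡A Y∘τ≡B rank-X rank-A rank-B dim-X+Y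
    with basis-exists (RestrictionKernel X τ)
           (λ v≋w (v∈X , v∘τ≈0) → RowSpace-resp X v≋w v∈X , λ t → trans (sym (v≋w (τ t))) (v∘τ≈0 t))
           (λ v → RowSpace? X v ×-dec FP.all? (λ t → v (τ t) ≈? 0#))
  ... | κ , g , g-basis = k≤x+κ⇒k+y≤a+x (rank[X]≤rank[A]+dim[ker] X∘τ≡A rank-X rank-A g-basis)
                                        (dim[ker]+rank[B]≤dim[X+Y] X∘τ≡A Y∘τ≡B g-basis rank-B dim-X+Y)

  Dim-+ₛ-comm : ∀ {N a} (U W : Subset N) → Dim (U +ₛ W) a → Dim (W +ₛ U) a
  Dim-+ₛ-comm U W ((vs , vs∈ , vs-indep) , no-more) =
    (vs , +ₛ-comm U W ∘ vs∈ , vs-indep) , λ ws ws∈ → no-more ws (+ₛ-comm W U ∘ ws∈)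

  SubspaceDist-≥ : ∀ {k N} {X Y : Matrix k N} → Rank X k → Rank Y k → ∀ {d} →
                   (∀ {a b} → Dim (RowSpace X +ₛ RowSpace Y) a → Dim (RowSpace X ∩ₛ RowSpace Y) b →
                              a ℕ.+ b ≤ k ℕ.+ k → d ℤ.≤ + a ℤ.- + b) →
                   ∃[ δ ] (SubspaceDist (RowSpace X) (RowSpace Y) δ × d ℤ.≤ δ)
  SubspaceDist-≥ {k} {X = X} {Y} rank-X rank-Y {d} bound = distance (grassmann X Y rank-X rank-Y)
    where
    distance : ∃[ a ] ∃[ b ] (Dim (RowSpace X +ₛ RowSpace Y) a × Dim (RowSpace X ∩ₛ RowSpace Y) b ×
                              a ℕ.+ b ≤ k ℕ.+ k) →
               ∃[ δ ] (SubspaceDist (RowSpace X) (RowSpace Y) δ × d ℤ.≤ δ)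
    distance (a , b , dim-X+Y , dim-X∩Y , a+b≤2k) =
      + a ℤ.- + b , (a , b , dim-X+Y , dim-X∩Y , P.refl) , bound dim-X+Y dim-X∩Y a+b≤2k

  block-SubspaceDist-bound :
    ∀ {k N n n′} {X Y : Matrix k N} {τ : Fin n → Fin N} {A B : Matrix k n}
      {τ′ : Fin n′ → Fin N} {X′ Y′ : Matrix k n′} →
    IsBlock X τ A → IsBlock Y τ B → IsBlock X τ′ X′ → IsBlock Y τ′ Y′ → Rank X k → Rank Y k → ∀ {d} →
    ((Rank A k × Rank B k × ∃[ δ ] (SubspaceDist (RowSpace A) (RowSpace B) δ × d ℤ.≤ δ))
     ⊎ (((∀ r t → A r t ≈ B r t) × Rank A k × ∃[ ρ ] (Rank (X′ -ₘ Y′) ρ × d ℤ.≤ + 2 ℤ.* + ρ))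
     ⊎ (∃[ a ] ∃[ b ] (Rank A a × Rank B b × d ℤ.≤ + 2 ℤ.* + ℤ.∣ + a ℤ.- + b ∣)))) →
    ∃[ δ ] (SubspaceDist (RowSpace X) (RowSpace Y) δ × d ℤ.≤ δ)
  block-SubspaceDist-bound X∘τ≡A Y∘τ≡B _ _ rank-X rank-Y
    (inj₁ (rank-A , _ , _ , (_ , _ , dim-A+B , dim-A∩B , P.refl) , d≤δ)) =
    SubspaceDist-≥ rank-X rank-Y λ dim-X+Y dim-X∩Y _ → ℤP.≤-trans d≤δ
      (ℤP.+-mono-≤ (ℤ.+≤+ (dim[A+B]≤dim[X+Y] X∘τ≡A Y∘τ≡B dim-A+B dim-X+Y))
                   (ℤP.neg-mono-≤ (ℤ.+≤+ (dim[X∩Y]≤dim[A∩B] X∘τ≡A Y∘τ≡B rank-A dim-X∩Y dim-A∩B))))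
  block-SubspaceDist-bound {k} X∘τ≡A Y∘τ≡B X∘τ′≡X′ Y∘τ′≡Y′ rank-X rank-Y
    (inj₂ (inj₁ (A≈B , rank-A , ρ , rank-X′-Y′ , d≤2ρ))) =
    SubspaceDist-≥ rank-X rank-Y λ {a} {b} dim-X+Y _ a+b≤2k →
      ℤP.≤-trans d≤2ρ (twice-excess≤distance {a} {b} {k} {ρ} a+b≤2k
      (P.subst (_≤ a) (ℕP.+-comm ρ _)
        (rank[X′-Y′]+k≤dim[X+Y] X∘τ≡A Y∘τ≡B X∘τ′≡X′ Y∘τ′≡Y′ A≈B rank-A rank-X rank-X′-Y′ dim-X+Y)))
  block-SubspaceDist-bound {k} X∘τ≡A Y∘τ≡B _ _ rank-X rank-Y
    (inj₂ (inj₂ (rA , rB , rank-A , rank-B , d≤2∣rA-rB∣))) =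
    SubspaceDist-≥ rank-X rank-Y λ {a} {b} dim-X+Y _ a+b≤2k →
      ℤP.≤-trans d≤2∣rA-rB∣ (twice-excess≤distance {a} {b} {k} {ℤ.∣ + rA ℤ.- + rB ∣} a+b≤2k
      (k+∣x-y∣≤a (k+rank[B]≤dim[X+Y]+rank[A] Y∘τ≡B X∘τ≡A rank-Y rank-B rank-A (Dim-+ₛ-comm _ _ dim-X+Y))
                 (k+rank[B]≤dim[X+Y]+rank[A] X∘τ≡A Y∘τ≡B rank-X rank-A rank-B dim-X+Y)))

lemma24 : ∀ {c ℓ : Level} (Fq : FiniteField c ℓ) →
    let open FiniteField Fq in
    let open LinAlg field' in
    (k m : ℕ) (n : Fin (suc m) → ℕ) (d : ℤ) →
    1 ≤ k → (∀ i → 1 ≤ n i) →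
    (A B : (i : Fin (suc m)) → Matrix k (n i)) →
    Rank (concat (suc m) n A) k →
    Rank (concat (suc m) n B) k →
    (∃[ i ]
      ((Rank (A i) k × Rank (B i) k ×
         ∃[ δ ] (SubspaceDist (RowSpace (A i)) (RowSpace (B i)) δ × d ℤ.≤ δ))
      ⊎ (((∀ r t → A i r t ≈ B i r t) × Rank (A i) k ×
         ∃[ ρ ] (Rank (concatWithout m n i A -ₘ concatWithout m n i B) ρ
                  × d ℤ.≤ + 2 ℤ.* + ρ))
      ⊎ (∃[ a ] ∃[ b ] (Rank (A i) a × Rank (B i) b
                  × d ℤ.≤ + 2 ℤ.* + ℤ.∣ + a ℤ.- + b ∣))))) →
    ∃[ δ ] (SubspaceDist (RowSpace (concat (suc m) n A))
                         (RowSpace (concat (suc m) n B)) δ × d ℤ.≤ δ)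
lemma24 Fq k m n d _ _ A B rank-X rank-Y (i , hypothesis) =
  block-SubspaceDist-bound (concat-IsBlock (suc m) n A i) (concat-IsBlock (suc m) n B i)
    (concatWithout-IsBlock m n A i) (concatWithout-IsBlock m n B i) rank-X rank-Y hypothesis
  where
  open FiniteField Fq
  open SpanProperties field'
  open FiniteDimension Fq
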